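{- Let $P$ be a parallelogram polyomino, $S$ its lower leftmost cell and $E$ its upper rightmost cell. The convexity degree of $P$ equals the minimum, over all internal paths of $P$ from $S$ to $E$ using only north and east steps, of the number of changes of direction of the path.
   Context: A polyomino is a finite edge-connected union of unit cells of $\mathbb{Z}^2$, up to translation; it is convex if all rows and columns are connected. A parallelogram polyomino is a polyomino whose boundary consists of two north/east lattice paths with common endpoints, otherwise disjoint; its lower leftmost and upper rightmost cells belong to it. An internal path is a sequence of distinct cells of the polyomino with consecutive cells edge-adjacent, each consecutive pair forming a north, south, east or west step; a monotone path is one whose steps lie in one of $\{n,e\},\{n,w\},\{s,e\},\{s,w\}$; a change of direction is a pair of consecutive steps of different types. A convex polyomino is $k$-convex if any two of its cells are joined by a monotone internal path with at most $k$ changes of direction; the convexity degree of a convex polyomino is the least $k$ for which it is $k$-convex. -}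

module Defs where

open import Data.Nat using (ℕ; zero; suc; _+_; _∸_; _≤_; _<_)
open import Data.Product using (Σ; _×_; _,_; ∃)
open import Data.Sum using (_⊎_)
open import Data.List using (List; []; _∷_)
open import Data.List.Membership.Propositional using (_∈_)
open import Data.List.Relation.Unary.All using (All)
open import Data.List.Relation.Unary.AllPairs using (AllPairs)
open import Data.Maybe using (Maybe; just; nothing)
open import Relation.Binary.PropositionalEquality using (_≡_; _≢_)

-- Lattice points and cells: the cell (i , j) is the unit square [i,i+1]×[j,j+1].
Point : Set
Point = ℕ × ℕ

Cell : Set
Cell = ℕ × ℕ

data LStep : Set where
  N E : LStep

LPath : Set
LPath = List LStep

points : Point → LPath → List Point
points p [] = p ∷ []
points (x , y) (N ∷ r) = (x , y) ∷ points (x , suc y) r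
points (x , y) (E ∷ r) = (x , y) ∷ points (suc x , y) r

countN : LPath → ℕ
countN [] = 0
countN (N ∷ r) = suc (countN r)
countN (E ∷ r) = countN r

countE : LPath → ℕ
countE [] = 0
countE (N ∷ r) = countE r
countE (E ∷ r) = suc (countE r)

-- heights of the successive east steps (the k-th entry is the height of
-- the east step going from abscissa k to abscissa k+1), starting at height h
eastHeights : ℕ → LPath → List ℕ
eastHeights h [] = []
eastHeights h (N ∷ r) = eastHeights (suc h) r
eastHeights h (E ∷ r) = h ∷ eastHeights h r

nth : {A : Set} → List A → ℕ → Maybe A
nth [] _ = nothing
nth (a ∷ as) zero = just a
nth (a ∷ as) (suc k) = nth as k

-- Parallelogram polyominoes (placed with the lower left corner at the
-- origin): given by an upper and a lower north/east path, with common
-- endpoints and otherwise disjoint.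

record Parallelogram : Set where
  field
    upper lower : LPath
    upperStartsN : Σ LPath λ r → upper ≡ N ∷ r
    lowerStartsE : Σ LPath λ r → lower ≡ E ∷ r
    sameN : countN upper ≡ countN lower
    sameE : countE upper ≡ countE lower
    disjoint : ∀ p → p ∈ points (0 , 0) upper → p ∈ points (0 , 0) lower →
               p ≡ (0 , 0) ⊎ p ≡ (countE upper , countN upper)

  width height : ℕ
  width = countE upper
  height = countN upper

-- cells of P: the cells enclosed between the two boundary paths
_∈P_ : Cell → Parallelogram → Set
(i , j) ∈P P = Σ ℕ λ a → Σ ℕ λ b →
  nth (eastHeights 0 (Parallelogram.lower P)) i ≡ just a ×
  nth (eastHeights 0 (Parallelogram.upper P)) i ≡ just b ×
  a ≤ j × j < b

startCell : Parallelogram → Cell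
startCell P = (0 , 0)

endCell : Parallelogram → Cell
endCell P = (Parallelogram.width P ∸ 1 , Parallelogram.height P ∸ 1)

data Dir : Set where
  n s e w : Dir

data Step : Cell → Cell → Dir → Set where
  north : ∀ {x y} → Step (x , y) (x , suc y) n
  south : ∀ {x y} → Step (x , suc y) (x , y) s
  east  : ∀ {x y} → Step (x , y) (suc x , y) e
  west  : ∀ {x y} → Step (suc x , y) (x , y) w

data Walk : Cell → Cell → List Cell → List Dir → Set where
  stop : ∀ {c} → Walk c c (c ∷ []) []
  step : ∀ {c c' d dir cs ds} → Step c c' dir → Walk c' d cs ds →
         Walk c d (c ∷ cs) (dir ∷ ds)

InternalPath : Parallelogram → Cell → Cell → List Dir → Set
InternalPath P c d ds = Σ (List Cell) λ cs →
  Walk c d cs ds × All (λ x → x ∈P P) cs × AllPairs _≢_ cs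

data Quadrant : Set where
  NE NW SE SW : Quadrant

Allowed : Quadrant → Dir → Set
Allowed NE d = d ≡ n ⊎ d ≡ e
Allowed NW d = d ≡ n ⊎ d ≡ w
Allowed SE d = d ≡ s ⊎ d ≡ e
Allowed SW d = d ≡ s ⊎ d ≡ w

Monotone : List Dir → Set
Monotone ds = Σ Quadrant λ q → All (Allowed q) ds

differ : Dir → Dir → ℕ
differ n n = 0
differ s s = 0
differ e e = 0
differ w w = 0
differ _ _ = 1

changes : List Dir → ℕ
changes [] = 0
changes (a ∷ []) = 0
changes (a ∷ b ∷ r) = differ a b + changes (b ∷ r)

KConvex : Parallelogram → ℕ → Set
KConvex P k = ∀ c d → c ∈P P → d ∈P P →
  Σ (List Dir) λ ds → InternalPath P c d ds × Monotone ds × changes ds ≤ k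

IsMin : (ℕ → Set) → ℕ → Set
IsMin Q k = Q k × (∀ m → Q m → k ≤ m)

ConvexityDegree : Parallelogram → ℕ → Set
ConvexityDegree P k = IsMin (KConvex P) k

NEPathChanges : Parallelogram → ℕ → Set
NEPathChanges P m = Σ (List Dir) λ ds →
  InternalPath P (startCell P) (endCell P) ds × All (Allowed NE) ds × changes ds ≡ m

module Submission where

-- Let k be that least number (it exists: a staircase path from S to E always
-- lies in P, and there are finitely many north/east step sequences of the
-- right length, so the predicate is decidable).  Then:
--  * P is k-convex.  For cells c, d with d north-east of c, clamp an optimal
--    S→E path into the box spanned by c and d: the clamped path runs from c to
--    d, stays in P, and its step sequence is a subsequence of the original
--    one, so it has at most k changes.  The south-west case is the reversal of
--    this.  If d is south-east (or north-west) of c, the L-shaped path along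
--    the box boundary lies in P and has at most one change, and k ≥ 1 as soon
--    as both legs are nonempty.
--  * If P is m-convex, the monotone path from S to E given by m-convexity is
--    necessarily north/east (S is the origin), so k ≤ m.

open import Defs
open import Data.Nat
open import Data.Nat.Properties
open import Data.Product using (Σ; _×_; _,_; proj₁; proj₂)
open import Data.Product.Properties using (≡-dec)
open import Data.Sum using (_⊎_; inj₁; inj₂)
open import Data.List using (List; []; _∷_; length; _++_; take; replicate; map)
open import Data.List.Properties using (++-identityʳ)
open import Data.List.Membership.Propositional using (_∈_; lose)
open import Data.List.Membership.Propositional.Properties using (∈-map⁺; ∈-++⁺ˡ; ∈-++⁺ʳ)
open import Data.List.Relation.Unary.Any using (here; there; any?; satisfied)
open import Data.List.Relation.Unary.All using (All; []; _∷_; all?; universal-U)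
import Data.List.Relation.Unary.All as All
open import Data.List.Relation.Unary.All.Properties using (++⁺)
open import Data.List.Relation.Unary.AllPairs using (AllPairs; []; _∷_)
open import Data.List.Relation.Binary.Sublist.Propositional using (_⊆_; []; _∷ʳ_; _∷_)
open import Data.List.Relation.Binary.Sublist.Propositional.Properties using (All-resp-⊆)
open import Data.Maybe using (just)
open import Data.Empty using (⊥-elim)
open import Relation.Binary.PropositionalEquality
open import Relation.Nullary using (¬_; Dec; yes; no)
open import Relation.Unary using (U)

-- total indexing into a list of naturals (default 0)
at : List ℕ → ℕ → ℕ
at [] _ = 0
at (a ∷ _) zero = a
at (_ ∷ as) (suc k) = at as k

nth-at : ∀ (l : List ℕ) i → i < length l → nth l i ≡ just (at l i)
nth-at (a ∷ l) zero _ = refl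
nth-at (a ∷ l) (suc i) (s≤s i<l) = nth-at l i i<l

nth-bound : ∀ {A : Set} (l : List A) i {v} → nth l i ≡ just v → i < length l
nth-bound (a ∷ l) zero _ = s≤s z≤n
nth-bound (a ∷ l) (suc i) eq = s≤s (nth-bound l i eq)

nth⇒at : ∀ (l : List ℕ) i {v} → nth l i ≡ just v → v ≡ at l i
nth⇒at (a ∷ l) zero refl = refl
nth⇒at (a ∷ l) (suc i) eq = nth⇒at l i eq

length-eastHeights : ∀ h p → length (eastHeights h p) ≡ countE p
length-eastHeights h [] = refl
length-eastHeights h (N ∷ p) = length-eastHeights (suc h) p
length-eastHeights h (E ∷ p) = cong suc (length-eastHeights h p)

eastHeights-≥ : ∀ h p i → i < countE p → h ≤ at (eastHeights h p) i
eastHeights-≥ h (N ∷ p) i lt = ≤-trans (n≤1+n h) (eastHeights-≥ (suc h) p i lt)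
eastHeights-≥ h (E ∷ p) zero lt = ≤-refl
eastHeights-≥ h (E ∷ p) (suc i) (s≤s lt) = eastHeights-≥ h p i lt

eastHeights-≤ : ∀ h p i → at (eastHeights h p) i ≤ h + countN p
eastHeights-≤ h [] i = z≤n
eastHeights-≤ h (N ∷ p) i =
  subst (at (eastHeights (suc h) p) i ≤_) (sym (+-suc h (countN p))) (eastHeights-≤ (suc h) p i)
eastHeights-≤ h (E ∷ p) zero = m≤m+n h _
eastHeights-≤ h (E ∷ p) (suc i) = eastHeights-≤ h p i

eastHeights-mono : ∀ h p {i j} → i ≤ j → j < countE p →
  at (eastHeights h p) i ≤ at (eastHeights h p) j
eastHeights-mono h (N ∷ p) i≤j j<c = eastHeights-mono (suc h) p i≤j j<c
eastHeights-mono h (E ∷ p) {zero} {zero} _ _ = ≤-refl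
eastHeights-mono h (E ∷ p) {zero} {suc j} _ (s≤s j<c) = eastHeights-≥ h p j j<c
eastHeights-mono h (E ∷ p) {suc i} {suc j} (s≤s i≤j) (s≤s j<c) = eastHeights-mono h p i≤j j<c

eastsIn northsIn : ℕ → LPath → ℕ
eastsIn t p = countE (take t p)
northsIn t p = countN (take t p)

eastsIn-≤suc : ∀ t p → eastsIn t p ≤ eastsIn (suc t) p
eastsIn-≤suc zero p = z≤n
eastsIn-≤suc (suc t) [] = z≤n
eastsIn-≤suc (suc t) (N ∷ p) = eastsIn-≤suc t p
eastsIn-≤suc (suc t) (E ∷ p) = s≤s (eastsIn-≤suc t p)

eastsIn-suc≤ : ∀ t p → eastsIn (suc t) p ≤ suc (eastsIn t p)
eastsIn-suc≤ zero [] = z≤n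
eastsIn-suc≤ zero (N ∷ p) = z≤n
eastsIn-suc≤ zero (E ∷ p) = s≤s z≤n
eastsIn-suc≤ (suc t) [] = z≤n
eastsIn-suc≤ (suc t) (N ∷ p) = eastsIn-suc≤ t p
eastsIn-suc≤ (suc t) (E ∷ p) = s≤s (eastsIn-suc≤ t p)

eastsIn-≤ : ∀ t p → eastsIn t p ≤ countE p
eastsIn-≤ zero p = z≤n
eastsIn-≤ (suc t) [] = z≤n
eastsIn-≤ (suc t) (N ∷ p) = eastsIn-≤ t p
eastsIn-≤ (suc t) (E ∷ p) = s≤s (eastsIn-≤ t p)

northsIn-≤ : ∀ t p → northsIn t p ≤ countN p
northsIn-≤ zero p = z≤n
northsIn-≤ (suc t) [] = z≤n
northsIn-≤ (suc t) (N ∷ p) = s≤s (northsIn-≤ t p)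
northsIn-≤ (suc t) (E ∷ p) = northsIn-≤ t p

eastsIn+northsIn : ∀ t p → t ≤ length p → eastsIn t p + northsIn t p ≡ t
eastsIn+northsIn zero p _ = refl
eastsIn+northsIn (suc t) (N ∷ p) (s≤s le) =
  trans (+-suc (eastsIn t p) (northsIn t p)) (cong suc (eastsIn+northsIn t p le))
eastsIn+northsIn (suc t) (E ∷ p) (s≤s le) = cong suc (eastsIn+northsIn t p le)

length≡countE+countN : ∀ p → length p ≡ countE p + countN p
length≡countE+countN [] = refl
length≡countE+countN (N ∷ p) =
  trans (cong suc (length≡countE+countN p)) (sym (+-suc (countE p) (countN p)))
length≡countE+countN (E ∷ p) = cong suc (length≡countE+countN p)

prefixEnd∈points : ∀ x₀ y₀ t p → (eastsIn t p + x₀ , northsIn t p + y₀) ∈ points (x₀ , y₀) p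
prefixEnd∈points x₀ y₀ zero [] = here refl
prefixEnd∈points x₀ y₀ zero (N ∷ p) = here refl
prefixEnd∈points x₀ y₀ zero (E ∷ p) = here refl
prefixEnd∈points x₀ y₀ (suc t) [] = here refl
prefixEnd∈points x₀ y₀ (suc t) (N ∷ p) = there (subst (λ z → (eastsIn t p + x₀ , z) ∈ points (x₀ , suc y₀) p)
  (+-suc (northsIn t p) y₀) (prefixEnd∈points x₀ (suc y₀) t p))
prefixEnd∈points x₀ y₀ (suc t) (E ∷ p) = there (subst (λ z → (z , northsIn t p + y₀) ∈ points (suc x₀ , y₀) p)
  (+-suc (eastsIn t p) x₀) (prefixEnd∈points (suc x₀) y₀ t p))

prefixEnd∈points₀ : ∀ t p → (eastsIn t p , northsIn t p) ∈ points (0 , 0) p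
prefixEnd∈points₀ t p = subst₂ (λ a b → (a , b) ∈ points (0 , 0) p)
  (+-identityʳ _) (+-identityʳ _) (prefixEnd∈points 0 0 t p)

-- The k-th east step of a path started at height h is its step number
-- k + (height − h) + 1; in the two directions:
eastStep-done⇒late : ∀ h p k T → k < eastsIn T p → suc (k + at (eastHeights h p) k) ≤ T + h
eastStep-done⇒late h (N ∷ p) k (suc T) lt = subst (suc (k + at (eastHeights (suc h) p) k) ≤_)
  (+-suc T h) (eastStep-done⇒late (suc h) p k T lt)
eastStep-done⇒late h (E ∷ p) zero (suc T) lt = s≤s (m≤n+m h T)
eastStep-done⇒late h (E ∷ p) (suc k) (suc T) (s≤s lt) = s≤s (eastStep-done⇒late h p k T lt)

eastStep-late⇒done : ∀ h p k → k < countE p → ∀ T → suc (k + at (eastHeights h p) k) ≤ T + h →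
  k < eastsIn T p
eastStep-late⇒done h (N ∷ p) k k<c zero le = ⊥-elim (<-irrefl refl (≤-trans (eastHeights-≥ (suc h) p k k<c)
  (≤-trans (m≤n+m _ k) (≤-trans (n≤1+n _) le))))
eastStep-late⇒done h (N ∷ p) k k<c (suc T) le = eastStep-late⇒done (suc h) p k k<c T
  (subst (suc (k + at (eastHeights (suc h) p) k) ≤_) (sym (+-suc T h)) le)
eastStep-late⇒done h (E ∷ p) zero k<c zero le = ⊥-elim (<-irrefl refl le)
eastStep-late⇒done h (E ∷ p) (suc k) (s≤s k<c) zero le = ⊥-elim (<-irrefl refl (≤-trans
  (s≤s (≤-trans (eastHeights-≥ h p k k<c) (≤-trans (m≤n+m _ k) (n≤1+n _)))) le))
eastStep-late⇒done h (E ∷ p) zero k<c (suc T) le = s≤s z≤n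
eastStep-late⇒done h (E ∷ p) (suc k) (s≤s k<c) (suc T) (s≤s le) = s≤s (eastStep-late⇒done h p k k<c T le)

-- The columns of a parallelogram polyomino

-- From the disjointness of the boundary paths we derive
-- that consecutive columns overlap and that the last column reaches the top.
module Columns (P : Parallelogram) where
  open Parallelogram P

  W H : ℕ
  W = countE upper
  H = countN upper

  lowerHeights upperHeights : List ℕ
  lowerHeights = eastHeights 0 lower
  upperHeights = eastHeights 0 upper

  bot top : ℕ → ℕ
  bot x = at lowerHeights x
  top x = at upperHeights x

  ∈P⇒column : ∀ {x y} → (x , y) ∈P P → x < W × bot x ≤ y × y < top x
  ∈P⇒column {x} {y} (a , b , ea , eb , a≤y , y<b) =
    subst (x <_) (length-eastHeights 0 upper) (nth-bound upperHeights x eb) ,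
    subst (_≤ y) (nth⇒at lowerHeights x ea) a≤y ,
    subst (y <_) (nth⇒at upperHeights x eb) y<b

  column⇒∈P : ∀ {x y} → x < W → bot x ≤ y → y < top x → (x , y) ∈P P
  column⇒∈P {x} {y} x<W b≤y y<t = bot x , top x ,
    nth-at lowerHeights x (subst (x <_) (sym (trans (length-eastHeights 0 lower) (sym sameE))) x<W) ,
    nth-at upperHeights x (subst (x <_) (sym (length-eastHeights 0 upper)) x<W) , b≤y , y<t

  bot-mono : ∀ {x x'} → x ≤ x' → x' < W → bot x ≤ bot x'
  bot-mono le lt = eastHeights-mono 0 lower le (subst (_ <_) sameE lt)

  top-mono : ∀ {x x'} → x ≤ x' → x' < W → top x ≤ top x'
  top-mono le lt = eastHeights-mono 0 upper le lt

  top≤H : ∀ x → top x ≤ H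
  top≤H x = eastHeights-≤ 0 upper x

  bot0 : bot 0 ≡ 0
  bot0 with lowerStartsE
  ... | _ , refl = refl

  1≤H : 1 ≤ H
  1≤H with upperStartsN
  ... | _ , refl = s≤s z≤n

  1≤W : 1 ≤ W
  1≤W with lowerStartsE
  ... | _ , el = subst (1 ≤_) (sym sameE) (subst (λ u → 1 ≤ countE u) (sym el) (s≤s z≤n))

  L : ℕ
  L = W + H

  t≤length-upper : ∀ {t} → t ≤ L → t ≤ length upper
  t≤length-upper = subst (_ ≤_) (sym (length≡countE+countN upper))

  t≤length-lower : ∀ {t} → t ≤ L → t ≤ length lower
  t≤length-lower = subst (_ ≤_) (sym (trans (length≡countE+countN lower) (sym (cong₂ _+_ sameE sameN))))

  prefixEnds-differ : ∀ t → 0 < t → t < L → eastsIn t upper ≢ eastsIn t lower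
  prefixEnds-differ t 0<t t<L eq
    with disjoint _ (prefixEnd∈points₀ t upper)
                    (subst₂ (λ a b → (a , b) ∈ points (0 , 0) lower) (sym eq) (sym sameNorths)
                            (prefixEnd∈points₀ t lower))
    where
    sameNorths : northsIn t upper ≡ northsIn t lower
    sameNorths = +-cancelˡ-≡ (eastsIn t upper) _ _
      (trans (eastsIn+northsIn _ upper (t≤length-upper (<⇒≤ t<L)))
             (sym (trans (cong (_+ northsIn t lower) eq) (eastsIn+northsIn _ lower (t≤length-lower (<⇒≤ t<L))))))
  ... | inj₁ atStart = <-irrefl (trans (sym (cong (λ q → proj₁ q + proj₂ q) atStart))
                                  (eastsIn+northsIn _ upper (t≤length-upper (<⇒≤ t<L)))) 0<t
  ... | inj₂ atEnd = <-irrefl (sym (trans (sym (cong (λ q → proj₁ q + proj₂ q) atEnd))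
                                    (eastsIn+northsIn _ upper (t≤length-upper (<⇒≤ t<L))))) t<L

  upper-left-of-lower : ∀ t → 1 ≤ t → t < L → eastsIn t upper < eastsIn t lower
  upper-left-of-lower (suc zero) _ _ with upperStartsN | lowerStartsE
  ... | _ , refl | _ , refl = s≤s z≤n
  upper-left-of-lower (suc (suc t)) _ lt = ≤∧≢⇒<
    (≤-trans (eastsIn-suc≤ (suc t) upper)
      (≤-trans (upper-left-of-lower (suc t) (s≤s z≤n) (<-trans (n<1+n _) lt)) (eastsIn-≤suc (suc t) lower)))
    (prefixEnds-differ (suc (suc t)) (s≤s z≤n) lt)

  columns-overlap : ∀ x → suc x < W → bot (suc x) < top x
  columns-overlap x lt = +-cancelˡ-≤ x _ _ (subst (_≤ x + top x) (sym (+-suc x (bot (suc x)))) (≤-pred lowerDone))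
    where
    T = suc (x + top x)
    upperDone : x < eastsIn T upper
    upperDone = eastStep-late⇒done 0 upper x (<-trans (n<1+n x) lt) T (≤-reflexive (sym (+-identityʳ T)))
    lowerDone : suc (suc x + bot (suc x)) ≤ T
    lowerDone = subst (suc (suc x + bot (suc x)) ≤_) (+-identityʳ T) (eastStep-done⇒late 0 lower (suc x) T
      (<-≤-trans (s≤s upperDone) (upper-left-of-lower T (s≤s z≤n) (+-mono-<-≤ lt (top≤H x)))))

  -- in the last column x = W − 1, the lower path has completed its east
  -- steps strictly before step x + H, the upper one at the latest then
  module LastColumn (x : ℕ) (last : suc x ≡ W) where
    T : ℕ
    T = x + H

    T<L : T < L
    T<L = subst (T <_) (cong (_+ H) last) (n<1+n T)

    lowerDone : x < eastsIn T lower → suc (x + bot x) ≤ T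
    lowerDone lt = subst (suc (x + bot x) ≤_) (+-identityʳ T) (eastStep-done⇒late 0 lower x T lt)

    upperAhead : eastsIn T upper < eastsIn T lower
    upperAhead = upper-left-of-lower T (≤-trans 1≤H (m≤n+m H x)) T<L

    reaches-top : H ≤ top x
    reaches-top with H ≤? top x
    ... | yes H≤t = H≤t
    ... | no H≰t = ⊥-elim (<-irrefl refl (≤-trans (<-≤-trans (s≤s upperDone) upperAhead)
                      (subst (eastsIn T lower ≤_) (trans (sym sameE) (sym last)) (eastsIn-≤ T lower))))
      where
      upperDone : x < eastsIn T upper
      upperDone = eastStep-late⇒done 0 upper x (subst (x <_) last (n<1+n x)) T
        (subst (suc (x + top x) ≤_) (sym (+-identityʳ T))
          (subst (_≤ T) (+-suc x (top x)) (+-monoʳ-≤ x (≰⇒> H≰t))))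

    bot<H : bot x < H
    bot<H = +-cancelˡ-≤ x _ _ (subst (_≤ x + H) (sym (+-suc x (bot x))) (lowerDone (≤-<-trans upperBehind upperAhead)))
      where
      upperBehind : x ≤ eastsIn T upper
      upperBehind = +-cancelʳ-≤ H x (eastsIn T upper)
        (subst (_≤ eastsIn T upper + H) (eastsIn+northsIn T upper (t≤length-upper (<⇒≤ T<L)))
          (+-monoʳ-≤ (eastsIn T upper) (northsIn-≤ T upper)))

InQuadrant : Quadrant → Cell → Cell → Set
InQuadrant NE (x , y) (x' , y') = x ≤ x' × y ≤ y'
InQuadrant NW (x , y) (x' , y') = x' ≤ x × y ≤ y'
InQuadrant SE (x , y) (x' , y') = x ≤ x' × y' ≤ y
InQuadrant SW (x , y) (x' , y') = x' ≤ x × y' ≤ y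

inQuadrant-refl : ∀ q c → InQuadrant q c c
inQuadrant-refl NE c = ≤-refl , ≤-refl
inQuadrant-refl NW c = ≤-refl , ≤-refl
inQuadrant-refl SE c = ≤-refl , ≤-refl
inQuadrant-refl SW c = ≤-refl , ≤-refl

inQuadrant-trans : ∀ q {a b c} → InQuadrant q a b → InQuadrant q b c → InQuadrant q a c
inQuadrant-trans NE (p , q) (p' , q') = ≤-trans p p' , ≤-trans q q'
inQuadrant-trans NW (p , q) (p' , q') = ≤-trans p' p , ≤-trans q q'
inQuadrant-trans SE (p , q) (p' , q') = ≤-trans p p' , ≤-trans q' q
inQuadrant-trans SW (p , q) (p' , q') = ≤-trans p' p , ≤-trans q' q

inQuadrant-antisym : ∀ q {a b} → InQuadrant q a b → InQuadrant q b a → a ≡ b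
inQuadrant-antisym NE (p , q) (p' , q') = cong₂ _,_ (≤-antisym p p') (≤-antisym q q')
inQuadrant-antisym NW (p , q) (p' , q') = cong₂ _,_ (≤-antisym p' p) (≤-antisym q q')
inQuadrant-antisym SE (p , q) (p' , q') = cong₂ _,_ (≤-antisym p p') (≤-antisym q' q)
inQuadrant-antisym SW (p , q) (p' , q') = cong₂ _,_ (≤-antisym p' p) (≤-antisym q' q)

step-inQuadrant : ∀ q {c c' d} → Step c c' d → Allowed q d → InQuadrant q c c'
step-inQuadrant NE north (inj₁ refl) = ≤-refl , n≤1+n _
step-inQuadrant NE east (inj₂ refl) = n≤1+n _ , ≤-refl
step-inQuadrant NW north (inj₁ refl) = ≤-refl , n≤1+n _
step-inQuadrant NW west (inj₂ refl) = n≤1+n _ , ≤-refl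
step-inQuadrant SE south (inj₁ refl) = ≤-refl , n≤1+n _
step-inQuadrant SE east (inj₂ refl) = n≤1+n _ , ≤-refl
step-inQuadrant SW south (inj₁ refl) = ≤-refl , n≤1+n _
step-inQuadrant SW west (inj₂ refl) = n≤1+n _ , ≤-refl

step-moves : ∀ {c c' d} → Step c c' d → c ≢ c'
step-moves north eq = <⇒≢ (n<1+n _) (cong proj₂ eq)
step-moves south eq = <⇒≢ (n<1+n _) (sym (cong proj₂ eq))
step-moves east eq = <⇒≢ (n<1+n _) (cong proj₁ eq)
step-moves west eq = <⇒≢ (n<1+n _) (sym (cong proj₁ eq))

walk-inQuadrant : ∀ q {a b cs ds} → Walk a b cs ds → All (Allowed q) ds → InQuadrant q a b
walk-inQuadrant q stop [] = inQuadrant-refl q _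
walk-inQuadrant q (step st wk) (al ∷ als) =
  inQuadrant-trans q (step-inQuadrant q st al) (walk-inQuadrant q wk als)

monotoneWalk-inBox : ∀ q {a b cs ds} → Walk a b cs ds → All (Allowed q) ds →
  All (λ z → InQuadrant q a z × InQuadrant q z b) cs
monotoneWalk-inBox q stop [] = (inQuadrant-refl q _ , inQuadrant-refl q _) ∷ []
monotoneWalk-inBox q (step st wk) (al ∷ als) =
  (inQuadrant-refl q _ , inQuadrant-trans q a≼a' (walk-inQuadrant q wk als)) ∷
  All.map (λ (a'≼z , z≼b) → inQuadrant-trans q a≼a' a'≼z , z≼b) (monotoneWalk-inBox q wk als)
  where a≼a' = step-inQuadrant q st al

monotoneWalk-distinct : ∀ q {a b cs ds} → Walk a b cs ds → All (Allowed q) ds → AllPairs _≢_ cs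
monotoneWalk-distinct q stop [] = [] ∷ []
monotoneWalk-distinct q (step st wk) (al ∷ als) =
  All.map (λ (a'≼z , _) a≡z → step-moves st (inQuadrant-antisym q a≼a'
             (subst (InQuadrant q _) (sym a≡z) a'≼z)))
          (monotoneWalk-inBox q wk als)
  ∷ monotoneWalk-distinct q wk als
  where a≼a' = step-inQuadrant q st al

concatWalk : ∀ (Q : Cell → Set) {a b c cs cs' ds ds'} → Walk a b cs ds → Walk b c cs' ds' →
  All Q cs → All Q cs' → Σ (List Cell) λ cs'' → Walk a c cs'' (ds ++ ds') × All Q cs''
concatWalk Q stop wk₂ _ q₂ = _ , wk₂ , q₂
concatWalk Q (step st wk₁) wk₂ (qa ∷ q₁) q₂ with concatWalk Q wk₁ wk₂ q₁ q₂
... | _ , wk , qs = _ , step st wk , qa ∷ qs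

walk-endpoints-in : ∀ {Q : Cell → Set} {a b cs ds} → Walk a b cs ds → All Q cs → Q a × Q b
walk-endpoints-in stop (qa ∷ []) = qa , qa
walk-endpoints-in (step _ wk) (qa ∷ qs) = qa , proj₂ (walk-endpoints-in wk qs)

northWalk : ∀ x y k → Σ (List Cell) λ cs → Walk (x , y) (x , k + y) cs (replicate k n)
northWalk x y zero = _ , stop
northWalk x y (suc k) with northWalk x (suc y) k
... | cs , wk = _ , step north (subst (λ z → Walk (x , suc y) (x , z) cs (replicate k n)) (+-suc k y) wk)

eastWalk : ∀ x y k → Σ (List Cell) λ cs → Walk (x , y) (k + x , y) cs (replicate k e)
eastWalk x y zero = _ , stop
eastWalk x y (suc k) with eastWalk (suc x) y k
... | cs , wk = _ , step east (subst (λ z → Walk (suc x , y) (z , y) cs (replicate k e)) (+-suc k x) wk)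

southWalk : ∀ x y k → Σ (List Cell) λ cs → Walk (x , k + y) (x , y) cs (replicate k s)
southWalk x y zero = _ , stop
southWalk x y (suc k) = _ , step south (proj₂ (southWalk x y k))

replicate-allowed : ∀ q {d} k → Allowed q d → All (Allowed q) (replicate k d)
replicate-allowed q zero _ = []
replicate-allowed q (suc k) a = a ∷ replicate-allowed q k a

-- Counting changes of direction

changesFrom : Dir → List Dir → ℕ
changesFrom a [] = 0
changesFrom a (b ∷ r) = differ a b + changesFrom b r

changes-∷ : ∀ a r → changes (a ∷ r) ≡ changesFrom a r
changes-∷ a [] = refl
changes-∷ a (b ∷ r) = cong (differ a b +_) (changes-∷ b r)

differ-self : ∀ a → differ a a ≡ 0
differ-self n = refl
differ-self s = refl
differ-self e = refl
differ-self w = refl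

differ≤1 : ∀ a b → differ a b ≤ 1
differ≤1 n n = z≤n
differ≤1 n s = s≤s z≤n
differ≤1 n e = s≤s z≤n
differ≤1 n w = s≤s z≤n
differ≤1 s n = s≤s z≤n
differ≤1 s s = z≤n
differ≤1 s e = s≤s z≤n
differ≤1 s w = s≤s z≤n
differ≤1 e n = s≤s z≤n
differ≤1 e s = s≤s z≤n
differ≤1 e e = z≤n
differ≤1 e w = s≤s z≤n
differ≤1 w n = s≤s z≤n
differ≤1 w s = s≤s z≤n
differ≤1 w e = s≤s z≤n
differ≤1 w w = z≤n

differ≡0⇒≡ : ∀ a b → differ a b ≡ 0 → a ≡ b
differ≡0⇒≡ n n _ = refl
differ≡0⇒≡ s s _ = refl
differ≡0⇒≡ e e _ = refl
differ≡0⇒≡ w w _ = refl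
differ≡0⇒≡ n s ()
differ≡0⇒≡ n e ()
differ≡0⇒≡ n w ()
differ≡0⇒≡ s n ()
differ≡0⇒≡ s e ()
differ≡0⇒≡ s w ()
differ≡0⇒≡ e n ()
differ≡0⇒≡ e s ()
differ≡0⇒≡ e w ()
differ≡0⇒≡ w n ()
differ≡0⇒≡ w s ()
differ≡0⇒≡ w e ()

differ-triangle : ∀ a b c → differ a c ≤ differ a b + differ b c
differ-triangle a b c with differ a b in ab | differ b c in bc
... | suc _ | _ = ≤-trans (differ≤1 a c) (s≤s z≤n)
... | zero | suc _ = ≤-trans (differ≤1 a c) (s≤s z≤n)
... | zero | zero with differ≡0⇒≡ a b ab | differ≡0⇒≡ b c bc
... | refl | refl = ≤-reflexive (differ-self a)

changesFrom-skip : ∀ a y ys → changesFrom a ys ≤ differ a y + changesFrom y ys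
changesFrom-skip a y [] = z≤n
changesFrom-skip a y (z ∷ zs) = subst (differ a z + changesFrom z zs ≤_)
  (+-assoc (differ a y) (differ y z) (changesFrom z zs))
  (+-monoˡ-≤ (changesFrom z zs) (differ-triangle a y z))

changesFrom-⊆ : ∀ a {xs ys} → xs ⊆ ys → changesFrom a xs ≤ changesFrom a ys
changesFrom-⊆ a [] = z≤n
changesFrom-⊆ a (_∷ʳ_ {ys = ys} y sub) = ≤-trans (changesFrom-⊆ a sub) (changesFrom-skip a y ys)
changesFrom-⊆ a (_∷_ {x = x} refl sub) = +-monoʳ-≤ (differ a x) (changesFrom-⊆ x sub)

changes-⊆ : ∀ {xs ys} → xs ⊆ ys → changes xs ≤ changes ys
changes-⊆ [] = z≤n
changes-⊆ (_∷ʳ_ {[]} y sub) = z≤n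
changes-⊆ (_∷ʳ_ {x ∷ xs} {ys} y sub) = subst₂ _≤_ (sym (changes-∷ x xs)) (sym (changes-∷ y ys))
  (≤-trans (m≤n+m (changesFrom x xs) (differ y x)) (changesFrom-⊆ y sub))
changes-⊆ (_∷_ {x = x} {xs} {ys = ys} refl sub) =
  subst₂ _≤_ (sym (changes-∷ x xs)) (sym (changes-∷ x ys)) (changesFrom-⊆ x sub)

changesFrom-run : ∀ a k → changesFrom a (replicate k a) ≡ 0
changesFrom-run a zero = refl
changesFrom-run a (suc k) = trans (cong (_+ changesFrom a (replicate k a)) (differ-self a)) (changesFrom-run a k)

changes-run : ∀ a k → changes (replicate k a) ≡ 0
changes-run a zero = refl
changes-run a (suc k) = trans (changes-∷ a (replicate k a)) (changesFrom-run a k)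

changesFrom-twoRuns : ∀ a b i j → changesFrom a (replicate i a ++ replicate j b) ≤ 1
changesFrom-twoRuns a b zero zero = z≤n
changesFrom-twoRuns a b zero (suc j) = subst (_≤ 1)
  (sym (trans (cong (differ a b +_) (changesFrom-run b j)) (+-identityʳ _))) (differ≤1 a b)
changesFrom-twoRuns a b (suc i) j = subst (_≤ 1)
  (sym (cong (_+ changesFrom a (replicate i a ++ replicate j b)) (differ-self a))) (changesFrom-twoRuns a b i j)

changes-twoRuns : ∀ a b i j → changes (replicate i a ++ replicate j b) ≤ 1
changes-twoRuns a b zero j = ≤-trans (≤-reflexive (changes-run b j)) z≤n
changes-twoRuns a b (suc i) j =
  subst (_≤ 1) (sym (changes-∷ a (replicate i a ++ replicate j b))) (changesFrom-twoRuns a b i j)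

twoRuns-changes≤ : ∀ a b i j {k} → (1 ≤ i → 1 ≤ j → 1 ≤ k) → changes (replicate i a ++ replicate j b) ≤ k
twoRuns-changes≤ a b zero j _ = ≤-trans (≤-reflexive (changes-run b j)) z≤n
twoRuns-changes≤ a b (suc i) zero _ =
  ≤-trans (≤-reflexive (trans (cong changes (++-identityʳ (replicate (suc i) a))) (changes-run a (suc i)))) z≤n
twoRuns-changes≤ a b (suc i) (suc j) turns = ≤-trans (changes-twoRuns a b (suc i) (suc j)) (turns (s≤s z≤n) (s≤s z≤n))

changesFrom≡0⇒run : ∀ a l → changesFrom a l ≡ 0 → All (_≡ a) l
changesFrom≡0⇒run a [] _ = []
changesFrom≡0⇒run a (b ∷ l) eq with differ a b in ab
... | zero with differ≡0⇒≡ a b ab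
...   | refl = refl ∷ changesFrom≡0⇒run a l eq

-- Reversing a walk

opposite : Dir → Dir
opposite n = s
opposite s = n
opposite e = w
opposite w = e

opposite-step : ∀ {c c' d} → Step c c' d → Step c' c (opposite d)
opposite-step north = south
opposite-step south = north
opposite-step east = west
opposite-step west = east

reverseSteps : List Dir → List Dir
reverseSteps [] = []
reverseSteps (d ∷ ds) = reverseSteps ds ++ (opposite d ∷ [])

reverseCells : List Cell → List Cell
reverseCells [] = []
reverseCells (c ∷ cs) = reverseCells cs ++ (c ∷ [])

snocWalk : ∀ {a b c cs ds d} → Walk a b cs ds → Step b c d → Walk a c (cs ++ (c ∷ [])) (ds ++ (d ∷ []))
snocWalk stop st = step st stop
snocWalk (step st' wk) st = step st' (snocWalk wk st)

reverseWalk : ∀ {a b cs ds} → Walk a b cs ds → Walk b a (reverseCells cs) (reverseSteps ds)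
reverseWalk stop = stop
reverseWalk (step st wk) = snocWalk (reverseWalk wk) (opposite-step st)

reverseCells-All : ∀ {Q : Cell → Set} {cs} → All Q cs → All Q (reverseCells cs)
reverseCells-All [] = []
reverseCells-All (q ∷ qs) = ++⁺ (reverseCells-All qs) (q ∷ [])

flipQuadrant : Quadrant → Quadrant
flipQuadrant NE = SW
flipQuadrant NW = SE
flipQuadrant SE = NW
flipQuadrant SW = NE

opposite-allowed : ∀ q {d} → Allowed q d → Allowed (flipQuadrant q) (opposite d)
opposite-allowed NE (inj₁ refl) = inj₁ refl
opposite-allowed NE (inj₂ refl) = inj₂ refl
opposite-allowed NW (inj₁ refl) = inj₁ refl
opposite-allowed NW (inj₂ refl) = inj₂ refl
opposite-allowed SE (inj₁ refl) = inj₁ refl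
opposite-allowed SE (inj₂ refl) = inj₂ refl
opposite-allowed SW (inj₁ refl) = inj₁ refl
opposite-allowed SW (inj₂ refl) = inj₂ refl

reverse-allowed : ∀ q {ds} → All (Allowed q) ds → All (Allowed (flipQuadrant q)) (reverseSteps ds)
reverse-allowed q [] = []
reverse-allowed q (a ∷ al) = ++⁺ (reverse-allowed q al) (opposite-allowed q a ∷ [])

differ-opposite : ∀ a b → differ (opposite a) (opposite b) ≡ differ b a
differ-opposite n n = refl
differ-opposite n s = refl
differ-opposite n e = refl
differ-opposite n w = refl
differ-opposite s n = refl
differ-opposite s s = refl
differ-opposite s e = refl
differ-opposite s w = refl
differ-opposite e n = refl
differ-opposite e s = refl
differ-opposite e e = refl
differ-opposite e w = refl
differ-opposite w n = refl
differ-opposite w s = refl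
differ-opposite w e = refl
differ-opposite w w = refl

changes-snoc : ∀ m a b → changes ((m ++ (a ∷ [])) ++ (b ∷ [])) ≡ changes (m ++ (a ∷ [])) + differ a b
changes-snoc [] a b = +-comm (differ a b) 0
changes-snoc (x ∷ []) a b =
  trans (cong (differ x a +_) (+-identityʳ (differ a b))) (cong (_+ differ a b) (sym (+-identityʳ (differ x a))))
changes-snoc (x ∷ y ∷ m) a b = trans (cong (differ x y +_) (changes-snoc (y ∷ m) a b))
  (sym (+-assoc (differ x y) _ (differ a b)))

changes-reverseSteps∷ : ∀ a l → changes (reverseSteps (a ∷ l)) ≡ changesFrom a l
changes-reverseSteps∷ a [] = refl
changes-reverseSteps∷ a (b ∷ l) = begin
  changes ((reverseSteps l ++ (opposite b ∷ [])) ++ (opposite a ∷ []))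
    ≡⟨ changes-snoc (reverseSteps l) (opposite b) (opposite a) ⟩
  changes (reverseSteps (b ∷ l)) + differ (opposite b) (opposite a)
    ≡⟨ cong₂ _+_ (changes-reverseSteps∷ b l) (differ-opposite b a) ⟩
  changesFrom b l + differ a b
    ≡⟨ +-comm (changesFrom b l) (differ a b) ⟩
  changesFrom a (b ∷ l) ∎
  where open ≡-Reasoning

changes-reverseSteps : ∀ l → changes (reverseSteps l) ≡ changes l
changes-reverseSteps [] = refl
changes-reverseSteps (a ∷ l) = trans (changes-reverseSteps∷ a l) (sym (changes-∷ a l))

-- Clamping into a box

-- the point of [lo , hi] nearest to v (when lo ≤ hi)
clamp : ℕ → ℕ → ℕ → ℕ
clamp lo hi v = lo + ((v ∸ lo) ⊓ (hi ∸ lo))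

suc∸-cases : ∀ v lo → suc v ∸ lo ≡ v ∸ lo ⊎ suc v ∸ lo ≡ suc (v ∸ lo)
suc∸-cases v zero = inj₂ refl
suc∸-cases zero (suc lo) = inj₁ (trans (0∸n≡0 lo) (sym (0∸n≡0 (suc lo))))
suc∸-cases (suc v) (suc lo) = suc∸-cases v lo

suc⊓-cases : ∀ t D → suc t ⊓ D ≡ t ⊓ D ⊎ suc t ⊓ D ≡ suc (t ⊓ D)
suc⊓-cases t zero = inj₁ (sym (⊓-zeroʳ t))
suc⊓-cases zero (suc D) = inj₂ refl
suc⊓-cases (suc t) (suc D) with suc⊓-cases t D
... | inj₁ eq = inj₁ (cong suc eq)
... | inj₂ eq = inj₂ (cong suc eq)

-- clamping is 1-Lipschitz and monotone: a unit step either disappears or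
-- stays a unit step in the same direction
clamp-suc : ∀ lo hi v → clamp lo hi (suc v) ≡ clamp lo hi v ⊎ clamp lo hi (suc v) ≡ suc (clamp lo hi v)
clamp-suc lo hi v with suc∸-cases v lo
... | inj₁ eq = inj₁ (cong (λ t → lo + (t ⊓ (hi ∸ lo))) eq)
... | inj₂ eq with suc⊓-cases (v ∸ lo) (hi ∸ lo)
...   | inj₁ eq₂ = inj₁ (cong (lo +_) (trans (cong (_⊓ (hi ∸ lo)) eq) eq₂))
...   | inj₂ eq₂ = inj₂ (trans (cong (lo +_) (trans (cong (_⊓ (hi ∸ lo)) eq) eq₂)) (+-suc lo _))

lo≤clamp : ∀ lo hi v → lo ≤ clamp lo hi v
lo≤clamp lo hi v = m≤m+n lo _

clamp≤hi : ∀ lo hi v → lo ≤ hi → clamp lo hi v ≤ hi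
clamp≤hi lo hi v lo≤hi = ≤-trans (+-monoʳ-≤ lo (m⊓n≤n (v ∸ lo) (hi ∸ lo))) (≤-reflexive (m+[n∸m]≡n lo≤hi))

clamp-below : ∀ lo hi v → v ≤ lo → clamp lo hi v ≡ lo
clamp-below lo hi v v≤lo = trans (cong (λ t → lo + (t ⊓ (hi ∸ lo))) (m≤n⇒m∸n≡0 v≤lo)) (+-identityʳ lo)

clamp-above : ∀ lo hi v → lo ≤ hi → hi ≤ v → clamp lo hi v ≡ hi
clamp-above lo hi v lo≤hi hi≤v = trans (cong (lo +_) (m≥n⇒m⊓n≡n (∸-monoˡ-≤ lo hi≤v))) (m+[n∸m]≡n lo≤hi)

clamp≤ : ∀ lo hi v → lo ≤ v → clamp lo hi v ≤ v
clamp≤ lo hi v lo≤v = ≤-trans (+-monoʳ-≤ lo (m⊓n≤m (v ∸ lo) (hi ∸ lo))) (≤-reflexive (m+[n∸m]≡n lo≤v))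

≤clamp : ∀ lo hi v → v ≤ hi → v ≤ clamp lo hi v
≤clamp lo hi v v≤hi with ≤-total v lo
... | inj₁ v≤lo = subst (v ≤_) (sym (clamp-below lo hi v v≤lo)) v≤lo
... | inj₂ lo≤v = ≤-trans (≤-reflexive (sym (m+[n∸m]≡n lo≤v)))
  (+-monoʳ-≤ lo (≤-reflexive (sym (m≤n⇒m⊓n≡m (∸-monoˡ-≤ lo v≤hi)))))

module Clamp (x₁ x₂ y₁ y₂ : ℕ) where
  clampCell : Cell → Cell
  clampCell (x , y) = (clamp x₁ x₂ x , clamp y₁ y₂ y)

  clamp-step : ∀ {c c' d} → Step c c' d → Step (clampCell c) (clampCell c') d ⊎ clampCell c ≡ clampCell c'
  clamp-step (north {x} {y}) with clamp-suc y₁ y₂ y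
  ... | inj₁ eq = inj₂ (cong (clamp x₁ x₂ x ,_) (sym eq))
  ... | inj₂ eq = inj₁ (subst (λ t → Step (clampCell (x , y)) (clamp x₁ x₂ x , t) n) (sym eq) north)
  clamp-step (south {x} {y}) with clamp-suc y₁ y₂ y
  ... | inj₁ eq = inj₂ (cong (clamp x₁ x₂ x ,_) eq)
  ... | inj₂ eq = inj₁ (subst (λ t → Step (clamp x₁ x₂ x , t) (clampCell (x , y)) s) (sym eq) south)
  clamp-step (east {x} {y}) with clamp-suc x₁ x₂ x
  ... | inj₁ eq = inj₂ (cong (_, clamp y₁ y₂ y) (sym eq))
  ... | inj₂ eq = inj₁ (subst (λ t → Step (clampCell (x , y)) (t , clamp y₁ y₂ y) e) (sym eq) east)
  clamp-step (west {x} {y}) with clamp-suc x₁ x₂ x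
  ... | inj₁ eq = inj₂ (cong (_, clamp y₁ y₂ y) eq)
  ... | inj₂ eq = inj₁ (subst (λ t → Step (t , clamp y₁ y₂ y) (clampCell (x , y)) w) (sym eq) west)

  SubWalk : (Cell → Set) → Cell → Cell → List Dir → Set
  SubWalk Q a b ds = Σ (List Cell) λ cs → Σ (List Dir) λ ds' → Walk a b cs ds' × ds' ⊆ ds × All Q cs

  clampWalk : ∀ (Q : Cell → Set) → (∀ {z} → Q z → Q (clampCell z)) → ∀ {a b cs ds} →
    Walk a b cs ds → All Q cs → SubWalk Q (clampCell a) (clampCell b) ds
  clampWalk Q closed stop (qa ∷ []) = _ , _ , stop , [] , closed qa ∷ []
  clampWalk Q closed {b = b} (step st wk) (qa ∷ qs) with clamp-step st | clampWalk Q closed wk qs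
  ... | inj₁ st' | cs' , ds' , wk' , sub , qs' = _ , _ , step st' wk' , refl ∷ sub , closed qa ∷ qs'
  ... | inj₂ eq  | cs' , ds' , wk' , sub , qs' =
    cs' , ds' , subst (λ c → Walk c (clampCell b) cs' ds') (sym eq) wk' , _ ∷ʳ sub , qs'

ne-walk-length : ∀ {a b cs ds} → Walk a b cs ds → All (Allowed NE) ds →
  length ds + (proj₁ a + proj₂ a) ≡ proj₁ b + proj₂ b
ne-walk-length stop [] = refl
ne-walk-length (step {ds = ds} (north {x} {y}) wk) (inj₁ refl ∷ al) = trans (sym (+-suc (length ds) (x + y)))
  (trans (cong (length ds +_) (sym (+-suc x y))) (ne-walk-length wk al))
ne-walk-length (step {ds = ds} (east {x} {y}) wk) (inj₂ refl ∷ al) =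
  trans (sym (+-suc (length ds) (x + y))) (ne-walk-length wk al)

north-walk-vertical : ∀ {a b cs ds} → Walk a b cs ds → All (_≡ n) ds → proj₁ a ≡ proj₁ b
north-walk-vertical stop [] = refl
north-walk-vertical (step north wk) (_ ∷ al) = north-walk-vertical wk al

east-walk-horizontal : ∀ {a b cs ds} → Walk a b cs ds → All (_≡ e) ds → proj₂ a ≡ proj₂ b
east-walk-horizontal stop [] = refl
east-walk-horizontal (step east wk) (_ ∷ al) = east-walk-horizontal wk al

ne-walk-turns : ∀ {a b cs ds} → Walk a b cs ds → All (Allowed NE) ds →
  proj₁ a < proj₁ b → proj₂ a < proj₂ b → 1 ≤ changes ds
ne-walk-turns {ds = []} stop [] x<x _ = ⊥-elim (<-irrefl refl x<x)
ne-walk-turns {ds = d ∷ r} wk (a ∷ _) x<x' y<y' with changesFrom d r in eq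
... | suc _ = subst (1 ≤_) (sym (trans (changes-∷ d r) eq)) (s≤s z≤n)
... | zero with changesFrom≡0⇒run d r eq | a
...   | run | inj₁ refl = ⊥-elim (<-irrefl (north-walk-vertical wk (refl ∷ run)) x<x')
...   | run | inj₂ refl = ⊥-elim (<-irrefl (east-walk-horizontal wk (refl ∷ run)) y<y')

origin-monotone⇒NE : ∀ q {b cs ds} → Walk (0 , 0) b cs ds → All (Allowed q) ds → All (Allowed NE) ds
origin-monotone⇒NE NE wk al = al
origin-monotone⇒NE NW wk al = fromColumn0 wk al
  where
  fromColumn0 : ∀ {y b cs ds} → Walk (0 , y) b cs ds → All (Allowed NW) ds → All (Allowed NE) ds
  fromColumn0 stop [] = []
  fromColumn0 (step north wk) (_ ∷ al) = inj₁ refl ∷ fromColumn0 wk al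
  fromColumn0 (step south wk) (inj₁ () ∷ _)
  fromColumn0 (step south wk) (inj₂ () ∷ _)
  fromColumn0 (step east wk) (inj₁ () ∷ _)
  fromColumn0 (step east wk) (inj₂ () ∷ _)
origin-monotone⇒NE SE wk al = fromRow0 wk al
  where
  fromRow0 : ∀ {x b cs ds} → Walk (x , 0) b cs ds → All (Allowed SE) ds → All (Allowed NE) ds
  fromRow0 stop [] = []
  fromRow0 (step east wk) (_ ∷ al) = inj₂ refl ∷ fromRow0 wk al
  fromRow0 (step north wk) (inj₁ () ∷ _)
  fromRow0 (step north wk) (inj₂ () ∷ _)
  fromRow0 (step west wk) (inj₁ () ∷ _)
  fromRow0 (step west wk) (inj₂ () ∷ _)
origin-monotone⇒NE SW stop [] = []
origin-monotone⇒NE SW (step () wk) (inj₁ refl ∷ al)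
origin-monotone⇒NE SW (step () wk) (inj₂ refl ∷ al)

move : Cell → Dir → Cell
move (x , y) n = (x , suc y)
move (x , y) s = (x , pred y)
move (x , y) e = (suc x , y)
move (x , y) w = (pred x , y)

cellsAlong : Cell → List Dir → List Cell
cellsAlong c [] = c ∷ []
cellsAlong c (d ∷ ds) = c ∷ cellsAlong (move c d) ds

endOf : Cell → List Dir → Cell
endOf c [] = c
endOf c (d ∷ ds) = endOf (move c d) ds

walk-determined : ∀ {c d cs ds} → Walk c d cs ds → cs ≡ cellsAlong c ds × d ≡ endOf c ds
walk-determined stop = refl , refl
walk-determined (step north wk) with walk-determined wk
... | refl , refl = refl , refl
walk-determined (step south wk) with walk-determined wk
... | refl , refl = refl , refl
walk-determined (step east wk) with walk-determined wk
... | refl , refl = refl , refl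
walk-determined (step west wk) with walk-determined wk
... | refl , refl = refl , refl

ne-walk : ∀ c {ds} → All (Allowed NE) ds → Walk c (endOf c ds) (cellsAlong c ds) ds
ne-walk c [] = stop
ne-walk (x , y) (inj₁ refl ∷ al) = step north (ne-walk (x , suc y) al)
ne-walk (x , y) (inj₂ refl ∷ al) = step east (ne-walk (suc x , y) al)

-- Finite search

allowedNE? : ∀ d → Dec (Allowed NE d)
allowedNE? n = yes (inj₁ refl)
allowedNE? e = yes (inj₂ refl)
allowedNE? s = no λ { (inj₁ ()) ; (inj₂ ()) }
allowedNE? w = no λ { (inj₁ ()) ; (inj₂ ()) }

neSequences : ℕ → List (List Dir)
neSequences zero = [] ∷ []
neSequences (suc l) = map (n ∷_) (neSequences l) ++ map (e ∷_) (neSequences l)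

∈-neSequences : ∀ {ds} → All (Allowed NE) ds → ds ∈ neSequences (length ds)
∈-neSequences [] = here refl
∈-neSequences (inj₁ refl ∷ al) = ∈-++⁺ˡ (∈-map⁺ (n ∷_) (∈-neSequences al))
∈-neSequences {e ∷ ds} (inj₂ refl ∷ al) =
  ∈-++⁺ʳ (map (n ∷_) (neSequences (length ds))) (∈-map⁺ (e ∷_) (∈-neSequences al))

least : (Q : ℕ → Set) → (∀ j → Dec (Q j)) → ∀ j₀ → Q j₀ → Σ ℕ (IsMin Q)
least Q Q? j₀ q₀ = search j₀ 0 (+-identityʳ j₀) (λ m ())
  where
  search : ∀ d k → d + k ≡ j₀ → (∀ m → m < k → ¬ Q m) → Σ ℕ (IsMin Q)
  search d k eq below with Q? k
  ... | yes qk = k , qk , λ m qm → ≮⇒≥ (λ m<k → below m m<k qm)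
  search zero k eq below | no ¬qk = ⊥-elim (¬qk (subst Q (sym eq) q₀))
  search (suc d) k eq below | no ¬qk = search d (suc k) (trans (+-suc d k) eq) below'
    where
    below' : ∀ m → m < suc k → ¬ Q m
    below' m m<1+k with m≤n⇒m<n∨m≡n (≤-pred m<1+k)
    ... | inj₁ m<k = below m m<k
    ... | inj₂ refl = ¬qk

monotone-internal : ∀ P {c d cs ds} q → Walk c d cs ds → All (Allowed q) ds → All (_∈P P) cs →
  InternalPath P c d ds
monotone-internal P q wk al inP = _ , wk , inP , monotoneWalk-distinct q wk al

Joins : Parallelogram → ℕ → Cell → Cell → Set
Joins P k c d = Σ (List Dir) λ ds → InternalPath P c d ds × Monotone ds × changes ds ≤ k

joins-sym : ∀ {P k c d} → Joins P k c d → Joins P k d c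
joins-sym {P} {k} (ds , (cs , wk , inP , _) , (q , al) , ch) =
  reverseSteps ds ,
  monotone-internal P (flipQuadrant q) (reverseWalk wk) al' (reverseCells-All inP) ,
  (flipQuadrant q , al') ,
  subst (_≤ k) (sym (changes-reverseSteps ds)) ch
  where al' = reverse-allowed q al

module Theorem (P : Parallelogram) where
  open Columns P

  start end : Cell
  start = startCell P
  end = endCell P

  cell-bounds : ∀ {x y} → (x , y) ∈P P → x ≤ W ∸ 1 × y ≤ H ∸ 1
  cell-bounds {x} p with ∈P⇒column p
  ... | x<W , _ , y<top = <⇒≤pred x<W , <⇒≤pred (≤-trans y<top (top≤H x))

  _∈P? : ∀ c → Dec (c ∈P P)
  (x , y) ∈P? with x <? W | bot x ≤? y | y <? top x
  ... | yes x<W | yes b≤y | yes y<t = yes (column⇒∈P x<W b≤y y<t)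
  ... | no x≮W | _ | _ = no λ p → x≮W (proj₁ (∈P⇒column p))
  ... | yes _ | no b≰y | _ = no λ p → b≰y (proj₁ (proj₂ (∈P⇒column p)))
  ... | yes _ | yes _ | no y≮t = no λ p → y≮t (proj₂ (proj₂ (∈P⇒column p)))

  -- P is closed under clamping into the box spanned by two of its cells
  -- (this is where the monotonicity of bot and top is used)
  clamp-preserves-P : ∀ {x₁ y₁ x₂ y₂} → (x₁ , y₁) ∈P P → (x₂ , y₂) ∈P P → x₁ ≤ x₂ → y₁ ≤ y₂ →
    ∀ {z} → z ∈P P → Clamp.clampCell x₁ x₂ y₁ y₂ z ∈P P
  clamp-preserves-P {x₁} {y₁} {x₂} {y₂} c d x₁≤x₂ y₁≤y₂ {x , y} z
    with ∈P⇒column c | ∈P⇒column d | ∈P⇒column z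
  ... | _ , b₁ , t₁ | x₂<W , b₂ , t₂ | x<W , b , t = column⇒∈P x'<W bot≤y' y'<top
    where
    x' = clamp x₁ x₂ x
    y' = clamp y₁ y₂ y
    x'≤x₂ : x' ≤ x₂
    x'≤x₂ = clamp≤hi x₁ x₂ x x₁≤x₂
    x'<W : x' < W
    x'<W = ≤-<-trans x'≤x₂ x₂<W
    bot≤y' : bot x' ≤ y'
    bot≤y' with ≤-total x x₁ | ≤-total y y₂
    ... | inj₁ x≤x₁ | _ = subst (λ t → bot t ≤ y') (sym (clamp-below x₁ x₂ x x≤x₁)) (≤-trans b₁ (lo≤clamp y₁ y₂ y))
    ... | inj₂ x₁≤x | inj₁ y≤y₂ = ≤-trans (bot-mono (clamp≤ x₁ x₂ x x₁≤x) x<W) (≤-trans b (≤clamp y₁ y₂ y y≤y₂))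
    ... | inj₂ _ | inj₂ y₂≤y =
      subst (bot x' ≤_) (sym (clamp-above y₁ y₂ y y₁≤y₂ y₂≤y)) (≤-trans (bot-mono x'≤x₂ x₂<W) b₂)
    y'<top : y' < top x'
    y'<top with ≤-total x₂ x | ≤-total y₁ y
    ... | inj₁ x₂≤x | _ = subst (λ t → y' < top t) (sym (clamp-above x₁ x₂ x x₁≤x₂ x₂≤x))
                            (≤-<-trans (clamp≤hi y₁ y₂ y y₁≤y₂) t₂)
    ... | inj₂ x≤x₂ | inj₁ y₁≤y =
      <-≤-trans (≤-<-trans (clamp≤ y₁ y₂ y y₁≤y) t) (top-mono (≤clamp x₁ x₂ x x≤x₂) x'<W)
    ... | inj₂ _ | inj₂ y≤y₁ =
      subst (_< top x') (sym (clamp-below y₁ y₂ y y≤y₁)) (<-≤-trans t₁ (top-mono (lo≤clamp x₁ x₂ x) x'<W))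

  rectangle⊆P : ∀ {a b z} → a ∈P P → b ∈P P → InQuadrant SE a z → InQuadrant SE z b → z ∈P P
  rectangle⊆P {_ , yₕ} {xᵣ , yₗ} {x , y} a b (xₗ≤x , y≤yₕ) (x≤xᵣ , yₗ≤y)
    with ∈P⇒column a | ∈P⇒column b
  ... | _ , _ , yₕ<top | xᵣ<W , botᵣ≤yₗ , _ =
    column⇒∈P x<W (≤-trans (bot-mono x≤xᵣ xᵣ<W) (≤-trans botᵣ≤yₗ yₗ≤y))
                  (<-≤-trans (≤-<-trans y≤yₕ yₕ<top) (top-mono xₗ≤x x<W))
    where
    x<W : x < W
    x<W = ≤-<-trans x≤xᵣ xᵣ<W

  NEWalkInP : Cell → Cell → Set
  NEWalkInP a b = Σ (List Cell) λ cs → Σ (List Dir) λ ds →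
    Walk a b cs ds × All (Allowed NE) ds × All (_∈P P) cs

  _⊕_ : ∀ {a b c} → NEWalkInP a b → NEWalkInP b c → NEWalkInP a c
  (_ , _ , wk₁ , al₁ , in₁) ⊕ (_ , _ , wk₂ , al₂ , in₂) with concatWalk (_∈P P) wk₁ wk₂ in₁ in₂
  ... | cs , wk , inP = cs , _ , wk , ++⁺ al₁ al₂ , inP

  east-then : ∀ {x y b} → (x , y) ∈P P → NEWalkInP (suc x , y) b → NEWalkInP (x , y) b
  east-then c (_ , _ , wk , al , inP) = _ , _ , step east wk , inj₂ refl ∷ al , c ∷ inP

  climb : ∀ {x y y'} → x < W → bot x ≤ y → y ≤ y' → y' < top x → NEWalkInP (x , y) (x , y')
  climb {x} {y} {y'} x<W b≤y y≤y' y'<t =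
    cs , _ , wk , al , All.map inColumn (monotoneWalk-inBox NE wk al)
    where
    cs = proj₁ (northWalk x y (y' ∸ y))
    wk : Walk (x , y) (x , y') cs (replicate (y' ∸ y) n)
    wk = subst (λ t → Walk (x , y) (x , t) cs (replicate (y' ∸ y) n)) (m∸n+n≡m y≤y') (proj₂ (northWalk x y (y' ∸ y)))
    al = replicate-allowed NE (y' ∸ y) (inj₁ refl)
    inColumn : ∀ {z} → InQuadrant NE (x , y) z × InQuadrant NE z (x , y') → z ∈P P
    inColumn {z₁ , z₂} ((x≤z₁ , y≤z₂) , (z₁≤x , z₂≤y')) with ≤-antisym z₁≤x x≤z₁
    ... | refl = column⇒∈P x<W (≤-trans b≤y y≤z₂) (≤-<-trans z₂≤y' y'<t)

  top-row : suc (H ∸ 1) ≡ H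
  top-row = m+[n∸m]≡n 1≤H

  last-column : suc (W ∸ 1) ≡ W
  last-column = m+[n∸m]≡n 1≤W

  ≤last⇒<W : ∀ {i} → i ≤ W ∸ 1 → i < W
  ≤last⇒<W i≤ = ≤-trans (s≤s i≤) (≤-reflexive last-column)

  -- the height the staircase climbs to in column x, when d columns remain
  Target : ℕ → ℕ → ℕ
  Target zero x = H ∸ 1
  Target (suc d) x = bot (suc x)

  staircase : ∀ d x y → d + x ≡ W ∸ 1 → bot x ≤ y → y ≤ Target d x → NEWalkInP (x , y) end
  staircase zero x y x≡last b≤y y≤T =
    subst (λ c → NEWalkInP (x , y) (c , H ∸ 1)) x≡last
      (climb x<W b≤y y≤T (<-≤-trans (≤-reflexive top-row) (LastColumn.reaches-top x lastX)))
    where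
    lastX : suc x ≡ W
    lastX = trans (cong suc x≡last) last-column
    x<W : x < W
    x<W = ≤-reflexive lastX
  staircase (suc d) x y eq b≤y y≤T =
    climb x<W b≤y y≤T (columns-overlap x 1+x<W)
      ⊕ east-then corner (staircase d (suc x) (bot (suc x)) eq' ≤-refl (next-target d eq'))
    where
    eq' : d + suc x ≡ W ∸ 1
    eq' = trans (+-suc d x) eq
    1+x<W : suc x < W
    1+x<W = ≤last⇒<W (≤-trans (m≤n+m (suc x) d) (≤-reflexive eq'))
    x<W : x < W
    x<W = <-trans (n<1+n x) 1+x<W
    corner : (x , bot (suc x)) ∈P P
    corner = column⇒∈P x<W (bot-mono (n≤1+n x) 1+x<W) (columns-overlap x 1+x<W)
    next-target : ∀ d → d + suc x ≡ W ∸ 1 → bot (suc x) ≤ Target d (suc x)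
    next-target zero 1+x≡last =
      <⇒≤pred (LastColumn.bot<H (suc x) (trans (cong suc 1+x≡last) last-column))
    next-target (suc d) eq'' = bot-mono (n≤1+n _) (≤last⇒<W (≤-trans (s≤s (m≤n+m (suc x) d)) (≤-reflexive eq'')))

  staircase-from-start : NEWalkInP start end
  staircase-from-start = staircase (W ∸ 1) 0 0 (+-identityʳ _) (≤-reflexive bot0) z≤n

  Realises : ℕ → List Dir → Set
  Realises j ds = InternalPath P start end ds × All (Allowed NE) ds × changes ds ≡ j

  realises? : ∀ j ds → Dec (Realises j ds)
  realises? j ds with all? allowedNE? ds
  ... | no ¬ne = no λ r → ¬ne (proj₁ (proj₂ r))
  ... | yes ne with changes ds ≟ j
  ...   | no ≢j = no λ r → ≢j (proj₂ (proj₂ r))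
  ...   | yes ≡j with ≡-dec _≟_ _≟_ (endOf start ds) end
  ...     | no ≢end = no λ { ((_ , wk , _) , _) → ≢end (sym (proj₂ (walk-determined wk))) }
  ...     | yes ≡end with all? _∈P? (cellsAlong start ds)
  ...       | no ∉P = no λ { ((_ , wk , inP , _) , _) → ∉P (subst (All (_∈P P)) (proj₁ (walk-determined wk)) inP) }
  ...       | yes inP = yes (monotone-internal P NE wk ne inP , ne , ≡j)
    where
    wk : Walk start end (cellsAlong start ds) ds
    wk = subst (λ c → Walk start c (cellsAlong start ds) ds) ≡end (ne-walk start ne)

  -- every north/east path from start to end has W + H − 2 steps,
  -- so only finitely many step sequences need to be inspected
  NEPathChanges? : ∀ j → Dec (NEPathChanges P j)
  NEPathChanges? j with any? (realises? j) (neSequences ((W ∸ 1) + (H ∸ 1)))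
  ... | yes r = yes (satisfied r)
  ... | no ¬r = no λ { (ds , r@((_ , wk , _) , ne , _)) →
    ¬r (lose (subst (λ l → ds ∈ neSequences l) (trans (sym (+-identityʳ _)) (ne-walk-length wk ne))
                    (∈-neSequences ne)) r) }

  -- the staircase shows that some value is attained
  optimal : Σ ℕ (IsMin (NEPathChanges P))
  optimal with staircase-from-start
  ... | _ , ds , wk , ne , inP =
    least (NEPathChanges P) NEPathChanges? (changes ds) (ds , monotone-internal P NE wk ne inP , ne , refl)

  k : ℕ
  k = proj₁ optimal

  optimal-turns : 1 ≤ W ∸ 1 → 1 ≤ H ∸ 1 → 1 ≤ k
  optimal-turns 1≤W-1 1≤H-1 with proj₁ (proj₂ optimal)
  ... | ds , (_ , wk , _) , ne , changes≡k = subst (1 ≤_) changes≡k (ne-walk-turns wk ne 1≤W-1 1≤H-1)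

  -- d north-east of c: clamp an optimal path into the box spanned by c and d
  joins-NE : ∀ {x₁ y₁ x₂ y₂} → (x₁ , y₁) ∈P P → (x₂ , y₂) ∈P P → x₁ ≤ x₂ → y₁ ≤ y₂ →
    Joins P k (x₁ , y₁) (x₂ , y₂)
  joins-NE {x₁} {y₁} {x₂} {y₂} c d x₁≤x₂ y₁≤y₂ with proj₁ (proj₂ optimal)
  ... | ds , (_ , wk , inP , _) , ne , changes≡k
    with Clamp.clampWalk x₁ x₂ y₁ y₂ (_∈P P) (clamp-preserves-P c d x₁≤x₂ y₁≤y₂) wk inP
  ... | cs' , ds' , wk' , ds'⊆ds , inP' =
    ds' , monotone-internal P NE wk'' ne' inP' , (NE , ne') , ≤-trans (changes-⊆ ds'⊆ds) (≤-reflexive changes≡k)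
    where
    ne' : All (Allowed NE) ds'
    ne' = All-resp-⊆ ds'⊆ds ne
    wk'' : Walk (x₁ , y₁) (x₂ , y₂) cs' ds'
    wk'' = subst₂ (λ a b → Walk a b cs' ds')
      (cong₂ _,_ (clamp-below x₁ x₂ 0 z≤n) (clamp-below y₁ y₂ 0 z≤n))
      (cong₂ _,_ (clamp-above x₁ x₂ _ x₁≤x₂ (proj₁ (cell-bounds d))) (clamp-above y₁ y₂ _ y₁≤y₂ (proj₂ (cell-bounds d))))
      wk'

  -- d south-east of c: go south, then east, along the box spanned by c and d
  joins-SE : ∀ {x₁ y₁ x₂ y₂} → (x₁ , y₁) ∈P P → (x₂ , y₂) ∈P P → x₁ ≤ x₂ → y₂ ≤ y₁ →
    Joins P k (x₁ , y₁) (x₂ , y₂)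
  joins-SE {x₁} {y₁} {x₂} {y₂} c d x₁≤x₂ y₂≤y₁
    with concatWalk U (proj₂ (southWalk x₁ y₂ (y₁ ∸ y₂))) (proj₂ (eastWalk x₁ y₂ (x₂ ∸ x₁)))
                      (universal-U _) (universal-U _)
  ... | cs , wk , _ = ds ,
    monotone-internal P SE wk' se (All.map (λ (c≼z , z≼d) → rectangle⊆P c d c≼z z≼d) (monotoneWalk-inBox SE wk' se)) ,
    (SE , se) , twoRuns-changes≤ s e (y₁ ∸ y₂) (x₂ ∸ x₁) turns
    where
    ds = replicate (y₁ ∸ y₂) s ++ replicate (x₂ ∸ x₁) e
    wk' : Walk (x₁ , y₁) (x₂ , y₂) cs ds
    wk' = subst₂ (λ a b → Walk a b cs ds) (cong (x₁ ,_) (m∸n+n≡m y₂≤y₁)) (cong (_, y₂) (m∸n+n≡m x₁≤x₂)) wk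
    se : All (Allowed SE) ds
    se = ++⁺ (replicate-allowed SE (y₁ ∸ y₂) (inj₁ refl)) (replicate-allowed SE (x₂ ∸ x₁) (inj₂ refl))
    turns : 1 ≤ y₁ ∸ y₂ → 1 ≤ x₂ ∸ x₁ → 1 ≤ k
    turns 1≤dy 1≤dx = optimal-turns (≤-trans 1≤dx (≤-trans (m∸n≤m x₂ x₁) (proj₁ (cell-bounds d))))
                                    (≤-trans 1≤dy (≤-trans (m∸n≤m y₁ y₂) (proj₂ (cell-bounds c))))

  -- the four relative positions of two cells; two are reduced to the
  -- other two by reversal
  k-convex : KConvex P k
  k-convex (x₁ , y₁) (x₂ , y₂) c d with ≤-total x₁ x₂ | ≤-total y₁ y₂
  ... | inj₁ x₁≤x₂ | inj₁ y₁≤y₂ = joins-NE c d x₁≤x₂ y₁≤y₂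
  ... | inj₂ x₂≤x₁ | inj₂ y₂≤y₁ = joins-sym {P} (joins-NE d c x₂≤x₁ y₂≤y₁)
  ... | inj₁ x₁≤x₂ | inj₂ y₂≤y₁ = joins-SE c d x₁≤x₂ y₂≤y₁
  ... | inj₂ x₂≤x₁ | inj₁ y₁≤y₂ = joins-sym {P} (joins-SE d c x₂≤x₁ y₁≤y₂)

  -- in an m-convex P, start and end are joined by a monotone path, which
  -- goes north/east since start is the origin
  k-least : ∀ m → KConvex P m → k ≤ m
  k-least m convex with walk-endpoints-in (proj₁ (proj₂ (proj₂ staircase-from-start)))
                                          (proj₂ (proj₂ (proj₂ (proj₂ staircase-from-start))))
  ... | start∈P , end∈P with convex start end start∈P end∈P
  ... | ds , path@(_ , wk , _) , (q , al) , changes≤m =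
    ≤-trans (proj₂ (proj₂ optimal) (changes ds) (ds , path , origin-monotone⇒NE q wk al , refl)) changes≤m

mainTheorem3 : (P : Parallelogram) →
    Σ ℕ λ k → ConvexityDegree P k × IsMin (NEPathChanges P) k
mainTheorem3 P = k , (k-convex , k-least) , proj₂ optimal
  where open Theorem P
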